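{- Let $k\geq 2$ and $n\geq 2k$ be integers. Then the maximum number of edges in a graph on $n$ vertices containing neither the star $S_{k+1}$ nor the path $P_{2k-1}$ as a subgraph is \[ \mathrm{ex}(n,\{S_{k+1},P_{2k-1}\})=\left\lfloor\frac{(k-1)n}{2}\right\rfloor. \]
   Context: $S_{m}$ denotes the star on $m$ vertices (one center adjacent to $m-1$ leaves) and $P_m$ denotes the path on $m$ vertices. For a family $\mathcal{F}$ of graphs, $\mathrm{ex}(n,\mathcal{F})$ is the maximum number of edges in an $n$-vertex graph containing no member of $\mathcal{F}$ as a subgraph. Note that being $S_{k+1}$-free is equivalent to having maximum degree at most $k-1$. -}

module Defs where

open import Data.Nat using (ℕ; zero; suc; _+_; _*_; _∸_; _<ᵇ_)
open import Data.Bool using (Bool; true; false; _∧_; if_then_else_)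
open import Data.Fin using (Fin; zero; suc; toℕ; inject₁)
open import Data.List using (List; map; allFin)
open import Data.Nat.ListAction using (sum)
open import Data.Product using (Σ; _×_)
open import Function.Definitions using (Injective)
open import Relation.Binary.PropositionalEquality using (_≡_)
open import Relation.Nullary using (¬_)

record Graph (n : ℕ) : Set where
  field
    adj   : Fin n → Fin n → Bool
    sym   : ∀ i j → adj i j ≡ adj j i
    loopless : ∀ i → adj i i ≡ false
open Graph public

Adj : ∀ {n} → Graph n → Fin n → Fin n → Set
Adj G i j = adj G i j ≡ true

edgeCount : ∀ {n} → Graph n → ℕ
edgeCount {n} G =
  sum (map (λ i → sum (map (λ j →
      if (toℕ i <ᵇ toℕ j) ∧ adj G i j then 1 else 0) (allFin n))) (allFin n))

-- G contains the star S_{m+1} (centre + m leaves) as a (not necessarily induced) subgraph: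
-- an injective map of its vertices (0 = centre, suc l = leaves) preserving edges.
ContainsStar : ∀ {n} → ℕ → Graph n → Set
ContainsStar {n} m G =
  Σ (Fin (suc m) → Fin n) λ f → Injective _≡_ _≡_ f × (∀ (l : Fin m) → Adj G (f zero) (f (suc l)))

-- G contains the path P_m (m vertices 0 - 1 - ... - (m-1)) as a subgraph.
ContainsPath : ∀ {n} → ℕ → Graph n → Set
ContainsPath {n} zero G = Σ (Fin zero → Fin n) λ f → Injective _≡_ _≡_ f
ContainsPath {n} (suc m) G =
  Σ (Fin (suc m) → Fin n) λ f → Injective _≡_ _≡_ f × (∀ (i : Fin m) → Adj G (f (inject₁ i)) (f (suc i)))

StarPathFree : ∀ {n} → ℕ → Graph n → Set
StarPathFree k G = ¬ ContainsStar k G × ¬ ContainsPath (2 * k ∸ 1) G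

module Submission where

-- Upper bound: a graph without S_{k+1} has maximum degree at most m = k − 1, so by the
-- handshake lemma twice its number of edges is at most m n.
--
-- Construction: a graph all of whose parts (unions of components) have at most 2m
-- vertices contains no P_{2m+1} = P_{2k−1}. Split n ≥ 2(m+1) into parts of m + e vertices
-- with 1 ≤ e ≤ m. On m + e vertices placed on a cycle, joining vertices at cyclic distance
-- more than l gives an m-regular graph when e = 2l + 1; when e = 2l the same construction
-- is (m−1)-regular and adding the matching {2i, 2i+1} makes every vertex but at most one
-- of degree m. Choosing the parts so that at most one has odd size with e even
-- gives degree sum at least m n − 1, that is, ⌊m n / 2⌋ edges.

open import Defs hiding (sym)
open import Data.Bool using (Bool; true; false; _∧_; _∨_; if_then_else_)
open import Data.Bool.Properties using (T-≡; T-∧; ∧-zeroʳ; ∧-identityʳ; ∧-comm; ∨-comm; ¬-not)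
open import Data.Empty using (⊥; ⊥-elim)
open import Data.Fin using (Fin; zero; suc; toℕ; inject₁; inject≤; _↑ˡ_; _↑ʳ_; splitAt; join)
open import Data.Fin.Properties
  using (injective⇒≤; toℕ-injective; inject≤-injective; toℕ<n; toℕ-↑ˡ; toℕ-↑ʳ;
         splitAt-↑ˡ; splitAt-↑ʳ; join-splitAt)
  renaming (suc-injective to fsuc-injective)
open import Data.List using (List; []; _∷_; tabulate; allFin; map)
open import Data.List.Properties using (map-tabulate; ∷-injectiveʳ)
open import Data.Nat
  using (ℕ; zero; suc; _+_; _*_; _∸_; _/_; _%_; _≤_; _<_; _≤ᵇ_; _<ᵇ_; _≡ᵇ_; z≤n; s≤s; z<s)
import Data.Nat.ListAction as ListAction
open import Data.Nat.DivMod using (m*n/n≡m; /-monoˡ-≤; m<n*o⇒m/o<n; m%n<n; m*n%n≡0; m≡m%n+[m/n]*n)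
open import Data.Nat.Properties
open import Data.Nat.Tactic.RingSolver using (solve-∀)
open import Data.Product using (Σ; _×_; _,_; proj₁)
open import Data.Sum using (_⊎_; inj₁; inj₂; [_,_]; [_,_]′)
open import Function using (_∘_; Equivalence)
open import Function.Bundles using (_⇔_; mk⇔)
open import Function.Definitions using (Injective)
open import Relation.Binary.PropositionalEquality
  using (_≡_; _≢_; refl; sym; trans; cong; cong₂; subst; subst₂; module ≡-Reasoning)
open import Relation.Nullary using (¬_; yes; no)
open import Relation.Nullary.Decidable using (does-⇔)
open import Algebra.Properties.CommutativeMonoid.Sum +-0-commutativeMonoid
  using (sum; sum-syntax; ∑-distrib-+; ∑-comm; sum-cong-≗; sum-replicate-zero)

∑-mono-≤ : ∀ {n} {f g : Fin n → ℕ} → (∀ i → f i ≤ g i) → sum f ≤ sum g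
∑-mono-≤ {zero}  f≤g = z≤n
∑-mono-≤ {suc n} f≤g = +-mono-≤ (f≤g zero) (∑-mono-≤ (f≤g ∘ suc))

∑-const : ∀ n c → ∑[ i < n ] c ≡ n * c
∑-const zero    c = refl
∑-const (suc n) c = cong (c +_) (∑-const n c)

∑-↑ : ∀ a b (f : Fin (a + b) → ℕ) → sum f ≡ ∑[ i < a ] f (i ↑ˡ b) + ∑[ j < b ] f (a ↑ʳ j)
∑-↑ zero    b f = refl
∑-↑ (suc a) b f = trans (cong (f zero +_) (∑-↑ a b (f ∘ suc))) (sym (+-assoc (f zero) _ _))

listSum-tabulate : ∀ {n} (f : Fin n → ℕ) → ListAction.sum (tabulate f) ≡ sum f
listSum-tabulate {zero}  f = refl
listSum-tabulate {suc n} f = cong (f zero +_) (listSum-tabulate (f ∘ suc))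

listSum-allFin : ∀ {n} (f : Fin n → ℕ) → ListAction.sum (map f (allFin n)) ≡ sum f
listSum-allFin f = trans (cong ListAction.sum (map-tabulate (λ i → i) f)) (listSum-tabulate f)

indicator : Bool → ℕ
indicator b = if b then 1 else 0

indicator≤1 : ∀ b → indicator b ≤ 1
indicator≤1 false = z≤n
indicator≤1 true  = s≤s z≤n

indicator-∨ : ∀ p q → (p ≡ true → q ≡ true → ⊥) → indicator (p ∨ q) ≡ indicator p + indicator q
indicator-∨ false q     _      = refl
indicator-∨ true  false _      = refl
indicator-∨ true  true  p∧q⇒⊥ = ⊥-elim (p∧q⇒⊥ refl refl)

∨≡true : ∀ p q → p ∨ q ≡ true → p ≡ true ⊎ q ≡ true
∨≡true true  q _   = inj₁ refl
∨≡true false q q≡t = inj₂ q≡t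

count : ∀ {n} → (Fin n → Bool) → ℕ
count {n} P = ∑[ i < n ] indicator (P i)

rank : ∀ {n} (P : Fin n → Bool) (i : Fin n) → P i ≡ true → Fin (count P)
rank P zero    Pi with P zero
rank P zero    Pi | true = zero
rank P (suc i) Pi with P zero
... | true  = suc (rank (P ∘ suc) i Pi)
... | false = rank (P ∘ suc) i Pi

rank-injective : ∀ {n} (P : Fin n → Bool) i j (Pi : P i ≡ true) (Pj : P j ≡ true) →
                 rank P i Pi ≡ rank P j Pj → i ≡ j
rank-injective P zero    zero    Pi Pj eq = refl
rank-injective P zero    (suc j) Pi Pj eq with P zero
rank-injective P zero    (suc j) Pi Pj () | true
rank-injective P (suc i) zero    Pi Pj eq with P zero
rank-injective P (suc i) zero    Pi Pj () | true
rank-injective P (suc i) (suc j) Pi Pj eq with P zero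
... | true  = cong suc (rank-injective (P ∘ suc) i j Pi Pj (fsuc-injective eq))
... | false = cong suc (rank-injective (P ∘ suc) i j Pi Pj eq)

select : ∀ {n} (P : Fin n → Bool) → Fin (count P) → Fin n
select {suc n} P k with P zero
select {suc n} P zero    | true  = zero
select {suc n} P (suc k) | true  = suc (select (P ∘ suc) k)
select {suc n} P k       | false = suc (select (P ∘ suc) k)

select-satisfies : ∀ {n} (P : Fin n → Bool) k → P (select P k) ≡ true
select-satisfies {suc n} P k with P zero in P0
select-satisfies {suc n} P zero    | true  = P0
select-satisfies {suc n} P (suc k) | true  = select-satisfies (P ∘ suc) k
select-satisfies {suc n} P k       | false = select-satisfies (P ∘ suc) k

select-injective : ∀ {n} (P : Fin n → Bool) → Injective _≡_ _≡_ (select P)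
select-injective {suc n} P {k} {k′} eq with P zero
select-injective {suc n} P {zero}  {zero}   eq | true  = refl
select-injective {suc n} P {suc k} {suc k′} eq | true  =
  cong suc (select-injective (P ∘ suc) (fsuc-injective eq))
select-injective {suc n} P {k}     {k′}     eq | false =
  select-injective (P ∘ suc) (fsuc-injective eq)

injection⇒≤count : ∀ {d n} (P : Fin n → Bool) (f : Fin d → Fin n) → Injective _≡_ _≡_ f →
                   (∀ t → P (f t) ≡ true) → d ≤ count P
injection⇒≤count P f f-injective Pf = injective⇒≤ {f = λ t → rank P (f t) (Pf t)}
  (λ {s} {t} eq → f-injective (rank-injective P (f s) (f t) (Pf s) (Pf t) eq))

degree : ∀ {n} → Graph n → Fin n → ℕ
degree G i = count (adj G i)

degreeSum : ∀ {n} → Graph n → ℕ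
degreeSum {n} G = ∑[ i < n ] degree G i

_≺_ : ∀ {n} → Fin n → Fin n → Bool
i ≺ j = toℕ i <ᵇ toℕ j

edgeCount≡∑ : ∀ {n} (G : Graph n) →
              edgeCount G ≡ ∑[ i < n ] ∑[ j < n ] indicator ((i ≺ j) ∧ adj G i j)
edgeCount≡∑ {n} G = trans (listSum-allFin (λ i → ListAction.sum (map (edge i) (allFin n))))
                          (sum-cong-≗ (λ i → listSum-allFin (edge i)))
  where
  edge : Fin n → Fin n → ℕ
  edge i j = indicator ((i ≺ j) ∧ adj G i j)

<ᵇ-trichotomy : ∀ x y → x ≢ y → indicator (x <ᵇ y) + indicator (y <ᵇ x) ≡ 1
<ᵇ-trichotomy zero    zero    x≢y = ⊥-elim (x≢y refl)
<ᵇ-trichotomy zero    (suc y) x≢y = refl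
<ᵇ-trichotomy (suc x) zero    x≢y = refl
<ᵇ-trichotomy (suc x) (suc y) x≢y = <ᵇ-trichotomy x y (x≢y ∘ cong suc)

adj-split : ∀ {n} (G : Graph n) i j →
            indicator (adj G i j) ≡ indicator ((i ≺ j) ∧ adj G i j) + indicator ((j ≺ i) ∧ adj G i j)
adj-split G i j with adj G i j in Gij
... | false rewrite ∧-zeroʳ (i ≺ j) | ∧-zeroʳ (j ≺ i) = refl
... | true  rewrite ∧-identityʳ (i ≺ j) | ∧-identityʳ (j ≺ i) =
  sym (<ᵇ-trichotomy (toℕ i) (toℕ j) (λ i≡j → i≢j (toℕ-injective i≡j)))
  where
  i≢j : i ≢ j
  i≢j refl with () ← trans (sym Gij) (loopless G i)

handshake : ∀ {n} (G : Graph n) → degreeSum G ≡ edgeCount G + edgeCount G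
handshake {n} G = begin
  ∑[ i < n ] ∑[ j < n ] indicator (adj G i j)
    ≡⟨ sum-cong-≗ (λ i → sum-cong-≗ (adj-split G i)) ⟩
  ∑[ i < n ] ∑[ j < n ] (forward i j + backward i j)
    ≡⟨ sum-cong-≗ (λ i → ∑-distrib-+ (forward i) (backward i)) ⟩
  ∑[ i < n ] (∑[ j < n ] forward i j + ∑[ j < n ] backward i j)
    ≡⟨ ∑-distrib-+ (λ i → ∑[ j < n ] forward i j) (λ i → ∑[ j < n ] backward i j) ⟩
  E + ∑[ i < n ] ∑[ j < n ] backward i j
    ≡⟨ cong (E +_) (∑-comm backward) ⟩
  E + ∑[ j < n ] ∑[ i < n ] backward i j
    ≡⟨ cong (E +_) (sum-cong-≗ λ j → sum-cong-≗ λ i → cong (indicator ∘ ((j ≺ i) ∧_)) (Graph.sym G i j)) ⟩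
  E + E
    ≡⟨ cong₂ _+_ (sym (edgeCount≡∑ G)) (sym (edgeCount≡∑ G)) ⟩
  edgeCount G + edgeCount G ∎
  where
  open ≡-Reasoning
  forward backward : Fin n → Fin n → ℕ
  forward  i j = indicator ((i ≺ j) ∧ adj G i j)
  backward i j = indicator ((j ≺ i) ∧ adj G i j)
  E = ∑[ i < n ] ∑[ j < n ] forward i j

degree⇒star : ∀ {n} (G : Graph n) k i → k ≤ degree G i → ContainsStar k G
degree⇒star G k i k≤deg = leg , leg-injective , λ l → select-satisfies (adj G i) (inject≤ l k≤deg)
  where
  leg : Fin (suc k) → _
  leg zero    = i
  leg (suc l) = select (adj G i) (inject≤ l k≤deg)
  centre≢leg : ∀ l → i ≢ leg (suc l)
  centre≢leg l eq with () ← trans (sym (loopless G i))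
    (trans (cong (adj G i) eq) (select-satisfies (adj G i) (inject≤ l k≤deg)))
  leg-injective : Injective _≡_ _≡_ leg
  leg-injective {zero}  {zero}   eq = refl
  leg-injective {zero}  {suc l}  eq = ⊥-elim (centre≢leg l eq)
  leg-injective {suc l} {zero}   eq = ⊥-elim (centre≢leg l (sym eq))
  leg-injective {suc l} {suc l′} eq =
    cong suc (inject≤-injective k≤deg k≤deg l l′ (select-injective (adj G i) eq))

star⇒degree : ∀ {n} (G : Graph n) k → ContainsStar k G → Σ (Fin n) λ i → k ≤ degree G i
star⇒degree G k (leg , leg-injective , adjacent) =
  leg zero , injection⇒≤count (adj G (leg zero)) (leg ∘ suc) (fsuc-injective ∘ leg-injective) adjacent

¬star⇒degree≤ : ∀ {n} (G : Graph n) m → ¬ ContainsStar (suc m) G → ∀ i → degree G i ≤ m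
¬star⇒degree≤ G m no-star i with degree G i ≤? m
... | yes deg≤m = deg≤m
... | no  deg≰m = ⊥-elim (no-star (degree⇒star G (suc m) i (≰⇒> deg≰m)))

degree≤⇒¬star : ∀ {n} (G : Graph n) m → (∀ i → degree G i ≤ m) → ¬ ContainsStar (suc m) G
degree≤⇒¬star G m deg≤m star with i , m<deg ← star⇒degree G (suc m) star = <⇒≱ m<deg (deg≤m i)

degreeSum≤ : ∀ {n} (G : Graph n) m → (∀ i → degree G i ≤ m) → degreeSum G ≤ m * n
degreeSum≤ {n} G m deg≤m = ≤-trans (∑-mono-≤ deg≤m) (≤-reflexive (trans (∑-const n m) (*-comm n m)))

n+n≡n*2 : ∀ n → n + n ≡ n * 2
n+n≡n*2 n = trans (cong (n +_) (sym (+-identityʳ n))) (*-comm 2 n)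

≤/2 : ∀ e x → e + e ≤ x → e ≤ x / 2
≤/2 e x e+e≤x = subst (_≤ x / 2) (m*n/n≡m e 2) (/-monoˡ-≤ 2 (subst (_≤ x) (n+n≡n*2 e) e+e≤x))

/2≡ : ∀ e x → e + e ≤ x → x ≤ suc (e + e) → x / 2 ≡ e
/2≡ e x e+e≤x x≤1+e+e = ≤-antisym (≤-pred (m<n*o⇒m/o<n x<[1+e]*2)) (≤/2 e x e+e≤x)
  where
  x<[1+e]*2 : x < suc e * 2
  x<[1+e]*2 = s≤s (subst (x ≤_) (cong suc (n+n≡n*2 e)) x≤1+e+e)

edgeCount≤ : ∀ {n} (G : Graph n) m → (∀ i → degree G i ≤ m) → edgeCount G ≤ (m * n) / 2
edgeCount≤ G m deg≤m = ≤/2 (edgeCount G) _ (subst (_≤ _) (handshake G) (degreeSum≤ G m deg≤m))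

edgeCount≡ : ∀ {n} (G : Graph n) m → (∀ i → degree G i ≤ m) → m * n ≤ degreeSum G + 1 →
             edgeCount G ≡ (m * n) / 2
edgeCount≡ {n} G m deg≤m m*n≤sum+1 = sym (/2≡ (edgeCount G) _
  (subst (_≤ _) (handshake G) (degreeSum≤ G m deg≤m))
  (subst (m * n ≤_) (trans (+-comm (degreeSum G) 1) (cong suc (handshake G))) m*n≤sum+1))

-- A part is a union of components; parts are named by their position in a nest of
-- disjoint unions.
record PartLabelling {n} (G : Graph n) (c : ℕ) : Set where
  field
    part : Fin n → List Bool
    code : Fin n → Fin c
    adjacent⇒same-part : ∀ u v → Adj G u v → part u ≡ part v
    code-injective     : ∀ u v → part u ≡ part v → code u ≡ code v → u ≡ v
open PartLabelling

path-within-part : ∀ {n c p} (G : Graph n) (L : PartLabelling G c) (f : Fin (suc p) → Fin n) →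
                   (∀ (i : Fin p) → Adj G (f (inject₁ i)) (f (suc i))) →
                   ∀ i → part L (f i) ≡ part L (f zero)
path-within-part             G L f adjacent zero    = refl
path-within-part {p = suc p} G L f adjacent (suc i) =
  trans (path-within-part G L (f ∘ suc) (adjacent ∘ suc) i)
        (sym (adjacent⇒same-part L _ _ (adjacent zero)))

path≤ : ∀ {n c} (G : Graph n) → PartLabelling G c → ∀ p → ContainsPath (suc p) G → suc p ≤ c
path≤ G L p (f , f-injective , adjacent) = injective⇒≤ {f = code L ∘ f} λ {s} {t} eq →
  f-injective (code-injective L (f s) (f t) (trans (same s) (sym (same t))) eq)
  where same = path-within-part G L f adjacent

singlePart : ∀ {n c} (G : Graph n) → n ≤ c → PartLabelling G c
singlePart G n≤c = record
  { part               = λ _ → []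
  ; code               = λ u → inject≤ u n≤c
  ; adjacent⇒same-part = λ _ _ _ → refl
  ; code-injective     = λ u v _ → inject≤-injective n≤c n≤c u v
  }

splitAt-injective : ∀ a b {u v : Fin (a + b)} → splitAt a u ≡ splitAt a v → u ≡ v
splitAt-injective a b {u} {v} eq =
  trans (sym (join-splitAt a b u)) (trans (cong (join a b) eq) (join-splitAt a b v))

module _ {a b} (G : Graph a) (H : Graph b) where

  adj⊎ : Fin a ⊎ Fin b → Fin a ⊎ Fin b → Bool
  adj⊎ (inj₁ x) (inj₁ y) = adj G x y
  adj⊎ (inj₂ x) (inj₂ y) = adj H x y
  adj⊎ (inj₁ x) (inj₂ y) = false
  adj⊎ (inj₂ x) (inj₁ y) = false

  adj⊎-sym : ∀ p q → adj⊎ p q ≡ adj⊎ q p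
  adj⊎-sym (inj₁ x) (inj₁ y) = Graph.sym G x y
  adj⊎-sym (inj₂ x) (inj₂ y) = Graph.sym H x y
  adj⊎-sym (inj₁ x) (inj₂ y) = refl
  adj⊎-sym (inj₂ x) (inj₁ y) = refl

  adj⊎-loopless : ∀ p → adj⊎ p p ≡ false
  adj⊎-loopless (inj₁ x) = loopless G x
  adj⊎-loopless (inj₂ y) = loopless H y

  _⊕_ : Graph (a + b)
  _⊕_ = record
    { adj      = λ u v → adj⊎ (splitAt a u) (splitAt a v)
    ; sym      = λ u v → adj⊎-sym (splitAt a u) (splitAt a v)
    ; loopless = λ u → adj⊎-loopless (splitAt a u)
    }

  degree-⊕ : ∀ u → degree _⊕_ u ≡ [ degree G , degree H ]′ (splitAt a u)
  degree-⊕ u = begin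
    degree _⊕_ u
      ≡⟨ ∑-↑ a b _ ⟩
    ∑[ x < a ] indicator (adj⊎ p (splitAt a (x ↑ˡ b))) + ∑[ y < b ] indicator (adj⊎ p (splitAt a (a ↑ʳ y)))
      ≡⟨ cong₂ _+_ (sum-cong-≗ (λ x → cong (indicator ∘ adj⊎ p) (splitAt-↑ˡ a x b)))
                   (sum-cong-≗ (λ y → cong (indicator ∘ adj⊎ p) (splitAt-↑ʳ a b y))) ⟩
    ∑[ x < a ] indicator (adj⊎ p (inj₁ x)) + ∑[ y < b ] indicator (adj⊎ p (inj₂ y))
      ≡⟨ by-side p ⟩
    [ degree G , degree H ]′ p ∎
    where
    open ≡-Reasoning
    p = splitAt a u
    by-side : ∀ p → ∑[ x < a ] indicator (adj⊎ p (inj₁ x)) + ∑[ y < b ] indicator (adj⊎ p (inj₂ y))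
                    ≡ [ degree G , degree H ]′ p
    by-side (inj₁ x) = trans (cong (degree G x +_) (sum-replicate-zero b)) (+-identityʳ _)
    by-side (inj₂ y) = cong (_+ degree H y) (sum-replicate-zero a)

  degreeSum-⊕ : degreeSum _⊕_ ≡ degreeSum G + degreeSum H
  degreeSum-⊕ = trans (∑-↑ a b (degree _⊕_)) (cong₂ _+_
    (sum-cong-≗ (λ x → trans (degree-⊕ (x ↑ˡ b)) (cong [ degree G , degree H ]′ (splitAt-↑ˡ a x b))))
    (sum-cong-≗ (λ y → trans (degree-⊕ (a ↑ʳ y)) (cong [ degree G , degree H ]′ (splitAt-↑ʳ a b y)))))

  degree≤-⊕ : ∀ m → (∀ x → degree G x ≤ m) → (∀ y → degree H y ≤ m) → ∀ u → degree _⊕_ u ≤ m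
  degree≤-⊕ m G≤m H≤m u = subst (_≤ m) (sym (degree-⊕ u))
    ([_,_] {C = λ p → [ degree G , degree H ]′ p ≤ m} G≤m H≤m (splitAt a u))

  labelling-⊕ : ∀ {c} → PartLabelling G c → PartLabelling H c → PartLabelling _⊕_ c
  labelling-⊕ L M = record
    { part               = part⊎ ∘ splitAt a
    ; code               = code⊎ ∘ splitAt a
    ; adjacent⇒same-part = λ u v → same-part (splitAt a u) (splitAt a v)
    ; code-injective     = λ u v eq eq′ → splitAt-injective a b (injective (splitAt a u) (splitAt a v) eq eq′)
    }
    where
    part⊎ = [ (false ∷_) ∘ part L , (true ∷_) ∘ part M ]′
    code⊎ = [ code L , code M ]′
    same-part : ∀ p q → adj⊎ p q ≡ true → part⊎ p ≡ part⊎ q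
    same-part (inj₁ x) (inj₁ y) xy = cong (false ∷_) (adjacent⇒same-part L x y xy)
    same-part (inj₂ x) (inj₂ y) xy = cong (true ∷_) (adjacent⇒same-part M x y xy)
    injective : ∀ p q → part⊎ p ≡ part⊎ q → code⊎ p ≡ code⊎ q → p ≡ q
    injective (inj₁ x) (inj₁ y) eq eq′ = cong inj₁ (code-injective L x y (∷-injectiveʳ eq) eq′)
    injective (inj₂ x) (inj₂ y) eq eq′ = cong inj₂ (code-injective M x y (∷-injectiveʳ eq) eq′)

_∪_ : ∀ {n} → Graph n → Graph n → Graph n
G ∪ H = record
  { adj      = λ i j → adj G i j ∨ adj H i j
  ; sym      = λ i j → cong₂ _∨_ (Graph.sym G i j) (Graph.sym H i j)
  ; loopless = λ i → cong₂ _∨_ (loopless G i) (loopless H i)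
  }

degree-∪ : ∀ {n} (G H : Graph n) → (∀ i j → Adj G i j → Adj H i j → ⊥) →
           ∀ i → degree (G ∪ H) i ≡ degree G i + degree H i
degree-∪ {n} G H disjoint i = trans (sum-cong-≗ {n} (λ j → indicator-∨ _ _ (disjoint i j)))
  (∑-distrib-+ (λ j → indicator (adj G i j)) (λ j → indicator (adj H i j)))

inRange : ℕ → ℕ → ℕ → Bool
inRange a b z = (a ≤ᵇ z) ∧ (z <ᵇ b)

inRange-lower : ∀ a b z → inRange a b z ≡ true → a ≤ z
inRange-lower a b z z∈ = ≤ᵇ⇒≤ a z (proj₁ (Equivalence.to T-∧ (Equivalence.from T-≡ z∈)))

inRange-suc : ∀ a b z → inRange (suc a) (suc b) (suc z) ≡ inRange a b z
inRange-suc zero    b z = refl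
inRange-suc (suc a) b z = refl

count-inRange : ∀ N a d → a + d ≤ N → ∑[ z < N ] indicator (inRange a (a + d) (toℕ z)) ≡ d
count-inRange N       zero    zero    _           = sum-replicate-zero N
count-inRange (suc N) zero    (suc d) (s≤s d≤N)   = cong suc (count-inRange N 0 d d≤N)
count-inRange (suc N) (suc a) d       (s≤s a+d≤N) =
  trans (sum-cong-≗ {N} (λ z → cong indicator (inRange-suc a (a + d) (toℕ z)))) (count-inRange N a d a+d≤N)

≤⇔+-≤ : ∀ k a b → a ≤ b ⇔ a + k ≤ b + k
≤⇔+-≤ k a b = mk⇔ (+-monoˡ-≤ k) (+-cancelʳ-≤ k a b)

-- Vertices 0, …, size − 1 lie on a cycle and are joined when their cyclic distance exceeds
-- l; ahead x y says that y is l + 1, …, l + D steps after x, without going round the cycle.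
module FarCirculant (l D : ℕ) where

  size : ℕ
  size = l + (suc l + D)

  ahead : ℕ → ℕ → Bool
  ahead x y = inRange (x + suc l) (x + suc l + D) y

  ahead-apart : ∀ x y → ahead x y ≡ true → x + suc l ≤ y
  ahead-apart x y = inRange-lower (x + suc l) (x + suc l + D) y

  ahead-wrap : ∀ x y → ahead y x ≡ ahead x (size + y)
  ahead-wrap x y = trans (∧-comm (y + suc l ≤ᵇ x) (x <ᵇ y + suc l + D))
    (cong₂ _∧_ (does-⇔ below (x <? _) (x + suc l ≤? _)) (does-⇔ above (y + suc l ≤? x) (size + y <? _)))
    where
    y+W+l≡size+y : ∀ l D y → y + suc l + D + l ≡ l + (suc l + D) + y
    y+W+l≡size+y = solve-∀
    y+L+W≡1+size+y : ∀ l D y → y + suc l + (suc l + D) ≡ suc (l + (suc l + D) + y)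
    y+L+W≡1+size+y = solve-∀
    below : x < y + suc l + D ⇔ x + suc l ≤ size + y
    below = subst₂ (λ p q → x < y + suc l + D ⇔ p ≤ q) (sym (+-suc x l)) (y+W+l≡size+y l D y)
                   (≤⇔+-≤ l (suc x) (y + suc l + D))
    above : y + suc l ≤ x ⇔ size + y < x + suc l + D
    above = subst₂ (λ p q → y + suc l ≤ x ⇔ p ≤ q) (y+L+W≡1+size+y l D y) (sym (+-assoc x (suc l) D))
                   (≤⇔+-≤ (suc l + D) (y + suc l) x)

  far : ℕ → ℕ → Bool
  far x y = ahead x y ∨ ahead y x

  not-ahead-self : ∀ x → ahead x x ≡ false
  not-ahead-self x = ¬-not λ x→x → <⇒≱ (m<m+n x z<s) (ahead-apart x x x→x)

  not-ahead-both : ∀ x y → ahead x y ≡ true → ahead y x ≡ true → ⊥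
  not-ahead-both x y x→y y→x = <⇒≱ (m<m+n x z<s)
    (≤-trans (+-monoˡ-≤ (suc l) (≤-trans (m≤m+n x (suc l)) (ahead-apart x y x→y))) (ahead-apart y x y→x))

  graph : Graph size
  graph = record
    { adj      = λ i j → far (toℕ i) (toℕ j)
    ; sym      = λ i j → ∨-comm (ahead (toℕ i) (toℕ j)) (ahead (toℕ j) (toℕ i))
    ; loopless = λ i → cong₂ _∨_ (not-ahead-self (toℕ i)) (not-ahead-self (toℕ i))
    }

  -- The vertices behind x are, shifted by size, the continuation of those ahead of it: together
  -- they form an interval of length D inside [0, 2 size).
  degree-graph : ∀ i → degree graph i ≡ D
  degree-graph i = begin
    ∑[ y < size ] indicator (ahead x (toℕ y) ∨ ahead (toℕ y) x)
      ≡⟨ sum-cong-≗ {size} (λ y → indicator-∨ _ _ (not-ahead-both x (toℕ y))) ⟩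
    ∑[ y < size ] (indicator (ahead x (toℕ y)) + indicator (ahead (toℕ y) x))
      ≡⟨ ∑-distrib-+ {size} (λ y → indicator (ahead x (toℕ y))) (λ y → indicator (ahead (toℕ y) x)) ⟩
    ∑[ y < size ] indicator (ahead x (toℕ y)) + ∑[ y < size ] indicator (ahead (toℕ y) x)
      ≡⟨ cong₂ _+_ (sum-cong-≗ {size} (λ y → cong (indicator ∘ ahead x) (sym (toℕ-↑ˡ y size))))
                   (sum-cong-≗ {size} (λ y → trans (cong indicator (ahead-wrap x (toℕ y)))
                                                   (cong (indicator ∘ ahead x) (sym (toℕ-↑ʳ size y))))) ⟩
    ∑[ y < size ] indicator (ahead x (toℕ (y ↑ˡ size))) + ∑[ y < size ] indicator (ahead x (toℕ (size ↑ʳ y)))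
      ≡⟨ sym (∑-↑ size size (λ z → indicator (ahead x (toℕ z)))) ⟩
    ∑[ z < size + size ] indicator (ahead x (toℕ z))
      ≡⟨ count-inRange (size + size) (x + suc l) D (subst (_≤ size + size) (sym (+-assoc x (suc l) D))
                       (+-mono-≤ (<⇒≤ (toℕ<n i)) (m≤n+m (suc l + D) l))) ⟩
    D ∎
    where
    open ≡-Reasoning
    x = toℕ i

partner : ℕ → ℕ
partner zero          = 1
partner (suc zero)    = 0
partner (suc (suc x)) = suc (suc (partner x))

partner-involutive : ∀ x → partner (partner x) ≡ x
partner-involutive zero          = refl
partner-involutive (suc zero)    = refl
partner-involutive (suc (suc x)) = cong (λ y → suc (suc y)) (partner-involutive x)

partner-distinct : ∀ x → (x ≡ᵇ partner x) ≡ false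
partner-distinct zero          = refl
partner-distinct (suc zero)    = refl
partner-distinct (suc (suc x)) = partner-distinct x

partner≤ : ∀ x → partner x ≤ suc x
partner≤ zero          = s≤s z≤n
partner≤ (suc zero)    = z≤n
partner≤ (suc (suc x)) = s≤s (s≤s (partner≤ x))

≤partner : ∀ x → x ≤ suc (partner x)
≤partner zero          = z≤n
≤partner (suc zero)    = s≤s z≤n
≤partner (suc (suc x)) = s≤s (s≤s (≤partner x))

matching : ∀ s → Graph s
matching s = record
  { adj      = λ i j → toℕ j ≡ᵇ partner (toℕ i)
  ; sym      = λ i j → does-⇔ (mk⇔ (swap (toℕ i) (toℕ j)) (swap (toℕ j) (toℕ i))) (_ ≟ _) (_ ≟ _)
  ; loopless = λ i → partner-distinct (toℕ i)
  }
  where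
  swap : ∀ x y → y ≡ partner x → x ≡ partner y
  swap x y y≡x′ = trans (sym (partner-involutive x)) (cong partner (sym y≡x′))

count-≡ᵇ : ∀ s c → ∑[ j < s ] indicator (toℕ j ≡ᵇ c) ≡ indicator (c <ᵇ s)
count-≡ᵇ zero    c       = refl
count-≡ᵇ (suc s) zero    = cong suc (sum-replicate-zero s)
count-≡ᵇ (suc s) (suc c) = count-≡ᵇ s c

degree-matching : ∀ {s} i → degree (matching s) i ≡ indicator (partner (toℕ i) <ᵇ s)
degree-matching {s} i = count-≡ᵇ s (partner (toℕ i))

matched-count : ∀ s → ∑[ i < s ] indicator (partner (toℕ i) <ᵇ s) + s % 2 ≡ s
matched-count zero          = refl
matched-count (suc zero)    = refl
matched-count (suc (suc s)) = cong (λ t → suc (suc t)) (matched-count s)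

record Extremal (m δ : ℕ) {n} (G : Graph n) : Set where
  field
    degree≤    : ∀ i → degree G i ≤ m
    parts      : PartLabelling G (m + m)
    deficiency : m * n ≤ degreeSum G + δ
open Extremal

ExtremalGraph : ℕ → ℕ → ℕ → Set
ExtremalGraph m δ n = Σ (Graph n) (Extremal m δ)

weaken-deficiency : ∀ {m δ δ′ n} → δ ≤ δ′ → ExtremalGraph m δ n → ExtremalGraph m δ′ n
weaken-deficiency δ≤δ′ (G , E) = G , record
  { degree≤ = degree≤ E ; parts = parts E ; deficiency = ≤-trans (deficiency E) (+-monoʳ-≤ _ δ≤δ′) }

extremal-⊕ : ∀ {m δ δ′ a b} {G : Graph a} {H : Graph b} →
             Extremal m δ G → Extremal m δ′ H → Extremal m (δ + δ′) (G ⊕ H)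
extremal-⊕ {m} {δ} {δ′} {a} {b} {G} {H} E F = record
  { degree≤    = degree≤-⊕ G H m (degree≤ E) (degree≤ F)
  ; parts      = labelling-⊕ G H (parts E) (parts F)
  ; deficiency = begin
      m * (a + b)                            ≡⟨ *-distribˡ-+ m a b ⟩
      m * a + m * b                          ≤⟨ +-mono-≤ (deficiency E) (deficiency F) ⟩
      (degreeSum G + δ) + (degreeSum H + δ′) ≡⟨ interchange (degreeSum G) δ (degreeSum H) δ′ ⟩
      (degreeSum G + degreeSum H) + (δ + δ′) ≡⟨ cong (_+ (δ + δ′)) (sym (degreeSum-⊕ G H)) ⟩
      degreeSum (G ⊕ H) + (δ + δ′)           ∎
  }
  where
  open ≤-Reasoning
  interchange : ∀ w x y z → (w + x) + (y + z) ≡ (w + y) + (x + z)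
  interchange = solve-∀

_⊕ᴱ_ : ∀ {m δ δ′ a b} →
       ExtremalGraph m δ a → ExtremalGraph m δ′ b → ExtremalGraph m (δ + δ′) (a + b)
(G , E) ⊕ᴱ (H , F) = G ⊕ H , extremal-⊕ E F

far-extremal : ∀ m l → l + suc l ≤ m → Extremal m 0 (FarCirculant.graph l m)
far-extremal m l 2l+1≤m = record
  { degree≤    = λ i → ≤-reflexive (degree-graph i)
  ; parts      = singlePart graph (subst (_≤ m + m) (+-assoc l (suc l) m) (+-monoˡ-≤ m 2l+1≤m))
  ; deficiency = ≤-reflexive (begin
      m * size            ≡⟨ *-comm m size ⟩
      size * m            ≡⟨ ∑-const size m ⟨
      ∑[ i < size ] m     ≡⟨ sum-cong-≗ {size} (λ i → sym (degree-graph i)) ⟩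
      degreeSum graph     ≡⟨ +-identityʳ _ ⟨
      degreeSum graph + 0 ∎)
  }
  where
  open FarCirculant l m
  open ≡-Reasoning

module EvenBlock (D l : ℕ) (1≤l : 1 ≤ l) where
  open FarCirculant l D

  block : Graph size
  block = graph ∪ matching size

  not-ahead-of-neighbour : ∀ x y → ahead x y ≡ true → y ≤ suc x → ⊥
  not-ahead-of-neighbour x y x→y y≤1+x = <-irrefl refl (≤-trans
    (subst (_≤ x + suc l) (+-comm x 2) (+-monoʳ-≤ x (s≤s 1≤l)))
    (≤-trans (ahead-apart x y x→y) y≤1+x))

  not-far-partner : ∀ x → far x (partner x) ≡ true → ⊥
  not-far-partner x far-xx′ with ∨≡true (ahead x (partner x)) (ahead (partner x) x) far-xx′
  ... | inj₁ x→x′ = not-ahead-of-neighbour x (partner x) x→x′ (partner≤ x)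
  ... | inj₂ x′→x = not-ahead-of-neighbour (partner x) x x′→x (≤partner x)

  far-matching-disjoint : ∀ i j → Adj graph i j → Adj (matching size) i j → ⊥
  far-matching-disjoint i j far-ij ij-matched = not-far-partner (toℕ i)
    (subst (λ y → far (toℕ i) y ≡ true) (≡ᵇ⇒≡ (toℕ j) _ (Equivalence.from T-≡ ij-matched)) far-ij)

  degree-block : ∀ i → degree block i ≡ D + indicator (partner (toℕ i) <ᵇ size)
  degree-block i = trans (degree-∪ graph (matching size) far-matching-disjoint i)
                         (cong₂ _+_ (degree-graph i) (degree-matching i))

  block-extremal : l + l ≤ suc D → Extremal (suc D) (size % 2) block
  block-extremal 2l≤1+D = record
    { degree≤    = λ i → subst (degree block i ≤_) (+-comm D 1)
                     (subst (_≤ D + 1) (sym (degree-block i)) (+-monoʳ-≤ D (indicator≤1 _)))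
    ; parts      = singlePart block
                     (subst₂ _≤_ (size≡ l D) (cong suc (sym (+-suc D D))) (s≤s (+-monoˡ-≤ D 2l≤1+D)))
    ; deficiency = ≤-reflexive (begin
        suc D * size
          ≡⟨ cong (_+ D * size) (matched-count size) ⟨
        (matched + size % 2) + D * size
          ≡⟨ rearrange matched (size % 2) (D * size) ⟩
        (D * size + matched) + size % 2
          ≡⟨ cong (λ t → (t + matched) + size % 2) (trans (*-comm D size) (sym (∑-const size D))) ⟩
        (∑[ i < size ] D + matched) + size % 2
          ≡⟨ cong (_+ size % 2) (∑-distrib-+ {size} (λ _ → D) matched-at) ⟨
        ∑[ i < size ] (D + matched-at i) + size % 2
          ≡⟨ cong (_+ size % 2) (sum-cong-≗ {size} (sym ∘ degree-block)) ⟩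
        degreeSum block + size % 2 ∎)
    }
    where
    open ≡-Reasoning
    matched-at : Fin size → ℕ
    matched-at i = indicator (partner (toℕ i) <ᵇ size)
    matched = ∑[ i < size ] matched-at i
    size≡ : ∀ l D → suc (l + l + D) ≡ l + (suc l + D)
    size≡ = solve-∀
    rearrange : ∀ a b c → (a + b) + c ≡ (c + a) + b
    rearrange = solve-∀

data Parity : ℕ → Set where
  even : ∀ l → Parity (l + l)
  odd  : ∀ l → Parity (suc (l + l))

parity : ∀ n → Parity n
parity zero = even zero
parity (suc n) with parity n
parity (suc .(l + l))       | even l = odd l
parity (suc .(suc (l + l))) | odd l  = subst Parity (cong suc (+-suc l l)) (even (suc l))

block : ∀ m e → 1 ≤ e → e ≤ m → ExtremalGraph m ((m + e) % 2) (m + e)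
block m e 1≤e e≤m with parity e
block m .(suc (l + l)) _ e≤m | odd l =
  subst (λ s → ExtremalGraph m (s % 2) s) (odd-size l m)
        (weaken-deficiency z≤n (FarCirculant.graph l m , far-extremal m l (subst (_≤ m) (sym (+-suc l l)) e≤m)))
  where
  odd-size : ∀ l m → l + (suc l + m) ≡ m + suc (l + l)
  odd-size = solve-∀
block (suc D) .(suc l + suc l) _ e≤m | even (suc l) =
  subst (λ s → ExtremalGraph (suc D) (s % 2) s) (even-size l D)
        (EvenBlock.block D (suc l) (s≤s z≤n) , EvenBlock.block-extremal D (suc l) (s≤s z≤n) e≤m)
  where
  even-size : ∀ l D → suc l + (suc (suc l) + D) ≡ suc D + (suc l + suc l)
  even-size = solve-∀

complete : ∀ m → 1 ≤ m → ExtremalGraph m 0 (suc m)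
complete m 1≤m = FarCirculant.graph 0 m , far-extremal m 0 1≤m

isolated : ExtremalGraph 1 1 1
isolated = G , record { degree≤ = λ _ → z≤n ; parts = singlePart G (s≤s z≤n) ; deficiency = ≤-refl }
  where
  G : Graph 1
  G = record { adj = λ _ _ → false ; sym = λ _ _ → refl ; loopless = λ _ → refl }

%2≤1 : ∀ n → n % 2 ≤ 1
%2≤1 n = ≤-pred (m%n<n n 2)

[n+n]%2≡0 : ∀ n → (n + n) % 2 ≡ 0
[n+n]%2≡0 n = trans (cong (_% 2) (n+n≡n*2 n)) (m*n%n≡0 n 2)

-- 2(m + 1) + r vertices are split as (m + 1) + (m + 1 + r) if r < m, and otherwise as
-- 2m + (m + 2), or as 2 + 2 + 1 when m = 1; only the last part can have deficiency 1.
extremal-base : ∀ m r → 1 ≤ m → r ≤ m → ExtremalGraph m 1 (suc m + (suc m + r))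
extremal-base m r 1≤m r≤m with m≤n⇒m<n∨m≡n r≤m
... | inj₁ r<m = subst (ExtremalGraph m 1) (cong (suc m +_) (+-suc m r))
  (weaken-deficiency (%2≤1 (m + suc r)) (complete m 1≤m ⊕ᴱ block m (suc r) (s≤s z≤n) r<m))
extremal-base (suc zero) .1 _ _ | inj₂ refl = complete 1 (s≤s z≤n) ⊕ᴱ (complete 1 (s≤s z≤n) ⊕ᴱ isolated)
extremal-base m@(suc (suc k)) .m _ _ | inj₂ refl = subst (ExtremalGraph m 1) (split-size m)
  (weaken-deficiency (subst (λ d → d + (m + 2) % 2 ≤ 1) (sym ([n+n]%2≡0 m)) (%2≤1 (m + 2)))
          (block m m (s≤s z≤n) ≤-refl ⊕ᴱ block m 2 (s≤s z≤n) (s≤s (s≤s z≤n))))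
  where
  split-size : ∀ m → (m + m) + (m + 2) ≡ suc m + (suc m + m)
  split-size = solve-∀

extremal-multiple : ∀ m q r → 1 ≤ m → r ≤ m → ExtremalGraph m 1 (q * suc m + (suc m + (suc m + r)))
extremal-multiple m zero    r 1≤m r≤m = extremal-base m r 1≤m r≤m
extremal-multiple m (suc q) r 1≤m r≤m = subst (ExtremalGraph m 1) (sym (+-assoc (suc m) (q * suc m) _))
  (complete m 1≤m ⊕ᴱ extremal-multiple m q r 1≤m r≤m)

extremal : ∀ m n → 1 ≤ m → 2 * suc m ≤ n → ExtremalGraph m 1 n
extremal m n 1≤m 2[1+m]≤n = subst (ExtremalGraph m 1) size≡n
  (extremal-multiple m (t / suc m) (t % suc m) 1≤m (≤-pred (m%n<n t (suc m))))
  where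
  open ≡-Reasoning
  t = n ∸ 2 * suc m
  rearrange : ∀ q m r → q * suc m + (suc m + (suc m + r)) ≡ 2 * suc m + (r + q * suc m)
  rearrange = solve-∀
  size≡n : t / suc m * suc m + (suc m + (suc m + t % suc m)) ≡ n
  size≡n = begin
    t / suc m * suc m + (suc m + (suc m + t % suc m)) ≡⟨ rearrange (t / suc m) m (t % suc m) ⟩
    2 * suc m + (t % suc m + t / suc m * suc m)        ≡⟨ cong (2 * suc m +_) (m≡m%n+[m/n]*n t (suc m)) ⟨
    2 * suc m + t                                      ≡⟨ m+[n∸m]≡n 2[1+m]≤n ⟩
    n                                                  ∎

extremal⇒starPathFree : ∀ {m n} → ExtremalGraph m 1 n →
                        Σ (Graph n) λ G → StarPathFree (suc m) G × edgeCount G ≡ (m * n) / 2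
extremal⇒starPathFree {m} (G , E) =
  G , (degree≤⇒¬star G m (degree≤ E) , no-path) , edgeCount≡ G m (degree≤ E) (deficiency E)
  where
  2[1+m]∸1≡1+2m : 2 * suc m ∸ 1 ≡ suc (m + m)
  2[1+m]∸1≡1+2m = trans (+-suc m (m + 0)) (cong (λ x → suc (m + x)) (+-identityʳ m))
  no-path : ¬ ContainsPath (2 * suc m ∸ 1) G
  no-path path = <-irrefl refl (path≤ G (parts E) (m + m) (subst (λ p → ContainsPath p G) 2[1+m]∸1≡1+2m path))

proposition2p1 : (k n : ℕ) → 2 ≤ k → 2 * k ≤ n →
    ((G : Graph n) → StarPathFree k G → edgeCount G ≤ ((k ∸ 1) * n) / 2)
    × Σ (Graph n) (λ G → StarPathFree k G × edgeCount G ≡ ((k ∸ 1) * n) / 2)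
proposition2p1 (suc m) n (s≤s 1≤m) 2k≤n =
  (λ G (no-star , _) → edgeCount≤ G m (¬star⇒degree≤ G m no-star)) ,
  extremal⇒starPathFree (extremal m n 1≤m 2k≤n)
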